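{- Let $k = k_1 + k_2 + \dots + k_s$ with $k, s > 0$ and all $k_i > 0$ integers. Call a triple $(a,b,c)$ of nonnegative integers a uniform $m$-palette if $a+b+c=m$ and $a,b,c \leq \lceil m/2\rceil$, and call a sequence $(p_1,\dots,p_s)$ where each $p_i$ is a uniform $k_i$-palette a uniform $(k_1,\dots,k_s)$-palette (two such are different if they differ as sequences). Then the number of uniform $(k_1,k_2,\dots,k_s)$-palettes is at least $k+1$.
   Context: A triple $(a,b,c)$ represents a multiset of colors from three colors (red, blue, green) with $a$ reds, $b$ blues and $c$ greens; palettes are compared as ordered triples. -}

module Defs where

open import Data.Nat using (ℕ; _+_; _≤_; ⌈_/2⌉)
open import Data.Product using (_×_; _,_)
open import Data.List using (List)
open import Data.List.Relation.Binary.Pointwise using (Pointwise)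
open import Relation.Binary.PropositionalEquality using (_≡_)

Palette : Set
Palette = ℕ × ℕ × ℕ

UniformPalette : ℕ → Palette → Set
UniformPalette m (a , b , c) =
  (a + b + c ≡ m) × (a ≤ ⌈ m /2⌉) × (b ≤ ⌈ m /2⌉) × (c ≤ ⌈ m /2⌉)

UniformSeqPalette : List ℕ → List Palette → Set
UniformSeqPalette ks ps = Pointwise (λ k p → UniformPalette k p) ks ps

-- The triples (j, ⌈m/2⌉ ∸ j, ⌊m/2⌋) for j ≤ ⌈m/2⌉ and (⌈m/2⌉, ⌊m/2⌋ ∸ j, j) for
-- j < ⌊m/2⌋ are m + 1 distinct uniform m-palettes. If A has at least
-- m + 1 distinct good elements and B at least n + 1, then A × B has at least
-- m + n + 1 good pairs: fix one element of each and vary the other coordinate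
-- (an L-shape in the grid). Induction over (k₁,…,kₛ) gives k + 1 palettes.
module Submission where

open import Defs
open import Level using (Level)
open import Function using (Injective; _∘_)
open import Data.Nat using (ℕ; suc; _<_; _≤_; _+_; _∸_; ⌈_/2⌉; ⌊_/2⌋; s≤s)
open import Data.Nat.Properties
open import Data.List using (List; []; _∷_; length; map; _++_; upTo)
open import Data.List.Properties using (length-map; length-++; length-upTo; ∷-injective)
open import Data.Nat.ListAction using (sum)
open import Data.List.Relation.Unary.All as All using (All; []; _∷_)
import Data.List.Relation.Unary.All.Properties as All
open import Data.List.Relation.Unary.Unique.Propositional using (Unique)
import Data.List.Relation.Unary.Unique.Propositional.Properties as Unique
open import Data.List.Relation.Unary.AllPairs using ([]; _∷_)
open import Data.List.Relation.Binary.Disjoint.Propositional using (Disjoint)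
open import Data.List.Relation.Binary.Pointwise using ([]; _∷_)
open import Data.Product using (Σ; _×_; _,_; proj₁; proj₂; uncurry)
open import Data.Product.Properties using (×-≡,≡→≡)
open import Relation.Unary using (Pred; _∩_; _⟨×⟩_)
open import Relation.Nullary using (¬_)
open import Relation.Binary.PropositionalEquality
  using (_≡_; _≢_; refl; sym; trans; cong; ≢-sym; module ≡-Reasoning)

private
  variable
    a b p q : Level
    A : Set a
    B : Set b

ManyDistinct : ℕ → Pred A p → Set _
ManyDistinct {A = A} n P = Σ (List A) λ L → n ≤ length L × Unique L × All P L

many-≤ : ∀ {m n} {P : Pred A p} → m ≤ n → ManyDistinct n P → ManyDistinct m P
many-≤ m≤n (L , n≤∣L∣ , unique , all) = L , ≤-trans m≤n n≤∣L∣ , unique , all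

upTo-many : ∀ n → ManyDistinct n (_< n)
upTo-many n = upTo n , ≤-reflexive (sym (length-upTo n)) , Unique.upTo⁺ n
            , All.applyUpTo⁺₁ _ n (λ i<n → i<n)

map-many : ∀ {n} {P : Pred A p} {Q : Pred B q} {f : A → B} →
           Injective _≡_ _≡_ f → (∀ {x} → P x → Q (f x)) →
           ManyDistinct n P → ManyDistinct n Q
map-many {f = f} f-inj P⇒Qf (L , n≤∣L∣ , unique , all) =
  map f L , ≤-trans n≤∣L∣ (≤-reflexive (sym (length-map f L))) ,
  Unique.map⁺ f-inj unique , All.map⁺ (All.map P⇒Qf all)

++-many : ∀ {m n} {P : Pred A p} (s : A → B) (c : B) →
          ManyDistinct m (λ x → P x × s x ≡ c) →
          ManyDistinct n (λ x → P x × s x ≢ c) →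
          ManyDistinct (m + n) P
++-many s c (L₁ , m≤∣L₁∣ , unique₁ , all₁) (L₂ , n≤∣L₂∣ , unique₂ , all₂) =
  L₁ ++ L₂ ,
  ≤-trans (+-mono-≤ m≤∣L₁∣ n≤∣L₂∣) (≤-reflexive (sym (length-++ L₁))) ,
  Unique.++⁺ unique₁ unique₂ disjoint ,
  All.++⁺ (All.map proj₁ all₁) (All.map proj₁ all₂)
  where
  disjoint : Disjoint L₁ L₂
  disjoint (x∈L₁ , x∈L₂) = proj₂ (All.lookup all₂ x∈L₂) (proj₂ (All.lookup all₁ x∈L₁))

uncons-many : ∀ {n} {P : Pred A p} → ManyDistinct (suc n) P →
              Σ A λ x → P x × ManyDistinct n (λ y → P y × y ≢ x)
uncons-many (x ∷ L , s≤s n≤∣L∣ , x∉L ∷ unique , Px ∷ all) =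
  x , Px , L , n≤∣L∣ , unique , All.zip (all , All.map ≢-sym x∉L)

×-many : ∀ {m n} {P : Pred A p} {Q : Pred B q} →
         ManyDistinct (suc m) P → ManyDistinct (suc n) Q →
         ManyDistinct (suc (m + n)) (P ⟨×⟩ Q)
×-many {m = m} {n} Ps Qs with uncons-many Ps | uncons-many Qs
... | x₀ , Px₀ , Ps′ | y₀ , Qy₀ , _ =
  many-≤ (≤-reflexive (cong suc (+-comm m n)))
    (++-many proj₁ x₀
      (map-many {f = x₀ ,_} (cong proj₂) (λ Qy → (Px₀ , Qy) , refl) Qs)
      (map-many {f = _, y₀} (cong proj₁) (λ (Py , y≢x₀) → (Py , Qy₀) , y≢x₀) Ps′))

module _ (m : ℕ) where
  private
    h = ⌈ m /2⌉
    h′ = ⌊ m /2⌋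

    h+h′≡m : h + h′ ≡ m
    h+h′≡m = trans (+-comm h h′) (⌊n/2⌋+⌈n/2⌉≡n m)

    h′≤h : h′ ≤ h
    h′≤h = ⌊n/2⌋≤⌈n/2⌉ m

    third : Palette → ℕ
    third (_ , _ , c) = c

    uniform-first : ∀ {j} → j < suc h → UniformPalette m (j , h ∸ j , h′)
    uniform-first {j} (s≤s j≤h) =
      trans (cong (_+ h′) (m+[n∸m]≡n j≤h)) h+h′≡m , j≤h , m∸n≤m h j , h′≤h

    uniform-second : ∀ {j} → j < h′ → UniformPalette m (h , h′ ∸ j , j)
    uniform-second {j} j<h′ = sum≡m , ≤-refl , ≤-trans (m∸n≤m h′ j) h′≤h , ≤-trans (<⇒≤ j<h′) h′≤h
      where
      open ≡-Reasoning
      sum≡m : h + (h′ ∸ j) + j ≡ m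
      sum≡m = begin
        h + (h′ ∸ j) + j   ≡⟨ +-assoc h (h′ ∸ j) j ⟩
        h + (h′ ∸ j + j)   ≡⟨ cong (h +_) (m∸n+n≡m (<⇒≤ j<h′)) ⟩
        h + h′             ≡⟨ h+h′≡m ⟩
        m                  ∎

  uniformPalettes : ManyDistinct (suc m) (UniformPalette m)
  uniformPalettes =
    many-≤ (≤-reflexive (cong suc (sym h+h′≡m)))
      (++-many third h′
        (map-many {f = λ j → j , h ∸ j , h′} (cong proj₁)
          (λ j<1+h → uniform-first j<1+h , refl) (upTo-many (suc h)))
        (map-many {f = λ j → h , h′ ∸ j , j} (cong third)
          (λ j<h′ → uniform-second j<h′ , <⇒≢ j<h′) (upTo-many h′)))

uniformSeqPalettes : ∀ ks → ManyDistinct (suc (sum ks)) (UniformSeqPalette ks)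
uniformSeqPalettes [] = [] ∷ [] , ≤-refl , [] ∷ [] , [] ∷ []
uniformSeqPalettes (m ∷ ks) =
  map-many {f = uncurry _∷_} (×-≡,≡→≡ ∘ ∷-injective) (uncurry _∷_)
    (×-many (uniformPalettes m) (uniformSeqPalettes ks))

lemma1p3 : (ks : List ℕ) → ¬ (ks ≡ []) → All (0 <_) ks →
    Σ (List (List Palette)) λ L →
      (suc (sum ks) ≤ length L) × Unique L × All (UniformSeqPalette ks) L
lemma1p3 ks _ _ = uniformSeqPalettes ks
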